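{- Every $2$-drawing of a path $P=(v_1,\dots,v_n)$ has ply-number at most $2$.
   Context: A $2$-drawing of a path $P=(v_1,\dots,v_m)$ is a straight-line drawing of $P$ in which all vertices lie on a common straight-line segment in the order $v_1,\dots,v_m$, and for each $i=2,\dots,m-1$ we have $\frac{\ell(v_{i-1},v_i)}{2}\le \ell(v_i,v_{i+1})\le 2\ell(v_{i-1},v_i)$, where $\ell(u,w)$ is the length of edge $(u,w)$. The ply-disk $D_v$ of a vertex $v$ is the open disk centered at $v$ with radius $r_v$ equal to half the length of the longest edge incident to $v$; for $q\in\mathbb{R}^2$, $S_q=\{D_v:\|v-q\|<r_v\}$; the ply-number of the drawing is $\max_q|S_q|$. -}

module Defs where

open import Level using (0ℓ)
open import Data.Nat as ℕ using (ℕ; suc)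
open import Data.Product using (Σ; _×_; _,_; ∃-syntax)
open import Data.Sum using (_⊎_)
open import Relation.Nullary using (¬_)
open import Relation.Binary.PropositionalEquality using (_≡_)
open import Algebra.Structures using (IsCommutativeRing)

-- An ordered field (the real numbers are one; agda-stdlib has no reals).
record OrderedField : Set₁ where
  infixl 6 _+_
  infixl 7 _*_
  infix 4 _<_
  field
    Carrier : Set
    _+_ _*_ : Carrier → Carrier → Carrier
    -_      : Carrier → Carrier
    0# 1#   : Carrier
    isCommutativeRing : IsCommutativeRing _≡_ _+_ _*_ -_ 0# 1#
    0≢1     : ¬ (0# ≡ 1#)
    inv     : (x : Carrier) → ¬ (x ≡ 0#) → Carrier
    inv-law : (x : Carrier) (p : ¬ (x ≡ 0#)) → x * inv x p ≡ 1#
    _<_     : Carrier → Carrier → Set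
    <-irrefl : ∀ x → ¬ (x < x)
    <-trans  : ∀ {x y z} → x < y → y < z → x < z
    <-tri    : ∀ x y → x < y ⊎ x ≡ y ⊎ y < x
    +-mono-< : ∀ {x y} z → x < y → x + z < y + z
    *-pos    : ∀ {x y} → 0# < x → 0# < y → 0# < x * y

  infix 4 _≤_
  _≤_ : Carrier → Carrier → Set
  x ≤ y = x < y ⊎ x ≡ y

  _-_ : Carrier → Carrier → Carrier
  x - y = x + (- y)

  2# 4# : Carrier
  2# = 1# + 1#
  4# = 2# * 2#

module Geometry (F : OrderedField) where
  open OrderedField F

  Point : Set
  Point = Carrier × Carrier

  _⊕_ : Point → Point → Point
  (a , b) ⊕ (c , d) = (a + c , b + d)

  _⊖_ : Point → Point → Point
  (a , b) ⊖ (c , d) = (a - c , b - d)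

  _·_ : Carrier → Point → Point
  t · (a , b) = (t * a , t * b)

  normSq : Point → Carrier
  normSq (a , b) = a * a + b * b

  distSq : Point → Point → Carrier
  distSq p q = normSq (p ⊖ q)

  -- A path (v 0, …, v (m-1)); edge e joins v e and v (suc e), for suc e < m.
  -- squared length of edge e
  lenSq : (ℕ → Point) → ℕ → Carrier
  lenSq v e = distSq (v (suc e)) (v e)

  OnSegmentInOrder : ℕ → (ℕ → Point) → Set
  OnSegmentInOrder m v =
    Σ Point λ a → Σ Point λ b → Σ (ℕ → Carrier) λ t →
      (∀ i → i ℕ.< m → (0# ≤ t i) × (t i ≤ 1#) × (v i ≡ a ⊕ (t i · (b ⊖ a))))
      × (∀ i → suc i ℕ.< m → t i ≤ t (suc i))

  -- the 2-drawing condition  ℓ(e)/2 ≤ ℓ(e+1) ≤ 2 ℓ(e)  for consecutive edges,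
  -- written with squared lengths (lengths are nonnegative)
  RatioCondition : ℕ → (ℕ → Point) → Set
  RatioCondition m v =
    ∀ e → suc (suc e) ℕ.< m →
      (lenSq v e ≤ 4# * lenSq v (suc e)) × (lenSq v (suc e) ≤ 4# * lenSq v e)

  TwoDrawing : ℕ → (ℕ → Point) → Set
  TwoDrawing m v = OnSegmentInOrder m v × RatioCondition m v

  Incident : ℕ → ℕ → ℕ → Set
  Incident m e j = suc e ℕ.< m × (e ≡ j ⊎ suc e ≡ j)

  -- q lies in the open ply-disk D_{v j}: ‖v j − q‖ < r_j, where r_j is half the
  -- longest incident edge; i.e. 4‖v j − q‖² < ℓ(e)² for some incident edge e
  -- (equivalently, < the maximum of the ℓ(e)²).
  InPlyDisk : ℕ → (ℕ → Point) → Point → ℕ → Set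
  InPlyDisk m v q j = ∃[ e ] Incident m e j × (4# * distSq (v j) q < lenSq v e)

module Submission where

-- Since consecutive edges differ in length by a factor of at most 2, the
-- ply-disk of a vertex has radius at most the length of each incident edge.
-- For i + 2 ≤ k the disks of v_i and v_k therefore have radii at most
-- ℓ(v_i, v_i+1) and ℓ(v_k-1, v_k), while their centres lie on the segment at
-- distance at least the sum of these two lengths: the disks are disjoint, so
-- no point lies in three ply-disks. Lengths are only available squared, and
-- the triangle inequality is recovered from Cauchy–Schwarz.

open import Defs
open import Algebra.Bundles using (CommutativeRing; RawRing)
open import Algebra.Solver.Ring.AlmostCommutativeRing
  using (fromCommutativeRing; _-Raw-AlmostCommutative⟶_; Induced-equivalence)
open import Data.Empty using (⊥; ⊥-elim)
open import Data.Maybe using (just; nothing)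
open import Data.Nat as ℕ using (ℕ; zero; suc; _∸_)
open import Data.Nat.Properties as ℕ using (0∸n≡0)
open import Data.Product using (_×_; _,_; proj₁; proj₂)
open import Data.Sum using (inj₁; inj₂)
open import Relation.Binary.Definitions using (WeaklyDecidable)
open import Relation.Binary.PropositionalEquality as ≡ using (_≡_)
open import Relation.Nullary using (¬_; yes)

-- Integer coefficients, encoded as pairs (a , b) read as a − b, let the ring
-- solver cancel terms in an arbitrary commutative ring.
module IntegerCoefficientSolver {c ℓ} (R : CommutativeRing c ℓ) where
  open CommutativeRing R
  open import Algebra.Properties.Semiring.Mult semiring
    using (×-homo-+; ×1-homo-*) renaming (_×_ to _×′_)
  open import Algebra.Properties.Ring ring using (x[y-z]≈xy-xz; [y-z]x≈yx-zx)
  open import Algebra.Properties.AbelianGroup +-abelianGroup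
    using (⁻¹-∙-comm; ⁻¹-anti-homo‿-; ε⁻¹≈ε)
  open import Algebra.Properties.CommutativeSemigroup +-commutativeSemigroup
    using (interchange)
  open import Relation.Binary.Reasoning.Setoid setoid

  -- A pair with one component zero; the solver can only cancel coefficients
  -- that are syntactically equal, so they are kept in this normal form.
  difference : ℕ → ℕ → ℕ × ℕ
  difference m n = m ∸ n , n ∸ m

  integers : RawRing _ _
  integers = record
    { Carrier = ℕ × ℕ
    ; _≈_     = _≡_
    ; _+_     = λ { (a , b) (c , d) → difference (a ℕ.+ c) (b ℕ.+ d) }
    ; _*_     = λ { (a , b) (c , d) →
                      difference (a ℕ.* c ℕ.+ b ℕ.* d) (a ℕ.* d ℕ.+ b ℕ.* c) }
    ; -_      = λ { (a , b) → b , a }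
    ; 0#      = 0 , 0
    ; 1#      = 1 , 0
    }

  ⟦_⟧ℤ : ℕ × ℕ → Carrier
  ⟦ a , b ⟧ℤ = a ×′ 1# - b ×′ 1#

  -‿+-interchange : ∀ w x y z → (w + x) - (y + z) ≈ (w - y) + (x - z)
  -‿+-interchange w x y z = begin
    (w + x) - (y + z)    ≈⟨ +-congˡ (⁻¹-∙-comm y z) ⟨
    (w + x) + (- y + - z) ≈⟨ interchange w x (- y) (- z) ⟩
    (w - y) + (x - z)    ∎

  -‿*-expand : ∀ w x y z → (w - x) * (y - z) ≈ (w * y + x * z) - (w * z + x * y)
  -‿*-expand w x y z = begin
    (w - x) * (y - z)                   ≈⟨ [y-z]x≈yx-zx (y - z) w x ⟩
    w * (y - z) - x * (y - z)           ≈⟨ +-cong (x[y-z]≈xy-xz w y z) (-‿cong (x[y-z]≈xy-xz x y z)) ⟩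
    (w * y - w * z) - (x * y - x * z)   ≈⟨ +-congˡ (⁻¹-anti-homo‿- (x * y) (x * z)) ⟩
    (w * y - w * z) + (x * z - x * y)   ≈⟨ -‿+-interchange (w * y) (x * z) (w * z) (x * y) ⟨
    (w * y + x * z) - (w * z + x * y)   ∎

  ⟦difference⟧ : ∀ m n → ⟦ difference m n ⟧ℤ ≈ m ×′ 1# - n ×′ 1#
  ⟦difference⟧ zero    n       rewrite 0∸n≡0 n = refl
  ⟦difference⟧ (suc m) zero    = refl
  ⟦difference⟧ (suc m) (suc n) = begin
    ⟦ difference m n ⟧ℤ                          ≈⟨ ⟦difference⟧ m n ⟩
    m ×′ 1# - n ×′ 1#                            ≈⟨ +-identityˡ _ ⟨
    0# + (m ×′ 1# - n ×′ 1#)                     ≈⟨ +-congʳ (-‿inverseʳ 1#) ⟨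
    (1# - 1#) + (m ×′ 1# - n ×′ 1#)              ≈⟨ -‿+-interchange 1# (m ×′ 1#) 1# (n ×′ 1#) ⟨
    (1# + m ×′ 1#) - (1# + n ×′ 1#)              ∎

  integers⟶R : integers -Raw-AlmostCommutative⟶ fromCommutativeRing R
  integers⟶R = record
    { ⟦_⟧    = ⟦_⟧ℤ
    ; +-homo = λ { (a , b) (c , d) → begin
        ⟦ difference (a ℕ.+ c) (b ℕ.+ d) ⟧ℤ             ≈⟨ ⟦difference⟧ (a ℕ.+ c) (b ℕ.+ d) ⟩
        (a ℕ.+ c) ×′ 1# - (b ℕ.+ d) ×′ 1#
          ≈⟨ +-cong (×-homo-+ 1# a c) (-‿cong (×-homo-+ 1# b d)) ⟩
        (a ×′ 1# + c ×′ 1#) - (b ×′ 1# + d ×′ 1#)      ≈⟨ -‿+-interchange _ _ _ _ ⟩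
        ⟦ a , b ⟧ℤ + ⟦ c , d ⟧ℤ                         ∎ }
    ; *-homo = λ { (a , b) (c , d) → begin
        ⟦ difference (a ℕ.* c ℕ.+ b ℕ.* d) (a ℕ.* d ℕ.+ b ℕ.* c) ⟧ℤ
          ≈⟨ ⟦difference⟧ (a ℕ.* c ℕ.+ b ℕ.* d) (a ℕ.* d ℕ.+ b ℕ.* c) ⟩
        (a ℕ.* c ℕ.+ b ℕ.* d) ×′ 1# - (a ℕ.* d ℕ.+ b ℕ.* c) ×′ 1#
          ≈⟨ +-cong (embed-*+* a c b d) (-‿cong (embed-*+* a d b c)) ⟩
        (a ×′ 1# * c ×′ 1# + b ×′ 1# * d ×′ 1#) - (a ×′ 1# * d ×′ 1# + b ×′ 1# * c ×′ 1#)
          ≈⟨ -‿*-expand _ _ _ _ ⟨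
        ⟦ a , b ⟧ℤ * ⟦ c , d ⟧ℤ                          ∎ }
    ; -‿homo = λ { (a , b) → sym (⁻¹-anti-homo‿- (a ×′ 1#) (b ×′ 1#)) }
    ; 0-homo = -‿inverseʳ 0#
    ; 1-homo = trans (+-cong (+-identityʳ 1#) ε⁻¹≈ε) (+-identityʳ 1#)
    }
    where
    embed-*+* : ∀ a c b d → (a ℕ.* c ℕ.+ b ℕ.* d) ×′ 1# ≈ a ×′ 1# * c ×′ 1# + b ×′ 1# * d ×′ 1#
    embed-*+* a c b d = trans (×-homo-+ 1# (a ℕ.* c) (b ℕ.* d)) (+-cong (×1-homo-* a c) (×1-homo-* b d))

  coefficient≟ : WeaklyDecidable (Induced-equivalence integers⟶R)
  coefficient≟ (a , b) (c , d) with a ℕ.≟ c | b ℕ.≟ d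
  ... | yes ≡.refl | yes ≡.refl = just refl
  ... | _        | _        = nothing

  open import Algebra.Solver.Ring integers (fromCommutativeRing R) integers⟶R coefficient≟ public
    using (solve; _:=_; _:+_; _:*_; _:-_; :-_)

module OrderedFieldProperties (F : OrderedField) where
  open OrderedField F
  open ≡ using (refl; sym; trans; cong; cong₂; subst; subst₂; module ≡-Reasoning)

  commutativeRing : CommutativeRing _ _
  commutativeRing = record { isCommutativeRing = isCommutativeRing }

  open CommutativeRing commutativeRing
    using ( +-comm; +-identityˡ; +-identityʳ; -‿inverseʳ
          ; *-comm; *-assoc; *-identityˡ; distribʳ; zeroˡ; zeroʳ )
  open IntegerCoefficientSolver commutativeRing public

  ≤-refl : ∀ {x} → x ≤ x
  ≤-refl = inj₂ refl

  <-≤-trans : ∀ {x y z} → x < y → y ≤ z → x < z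
  <-≤-trans x<y (inj₁ y<z)  = <-trans x<y y<z
  <-≤-trans x<y (inj₂ refl) = x<y

  ≤-<-trans : ∀ {x y z} → x ≤ y → y < z → x < z
  ≤-<-trans (inj₁ x<y)  y<z = <-trans x<y y<z
  ≤-<-trans (inj₂ refl) y<z = y<z

  ≤-trans : ∀ {x y z} → x ≤ y → y ≤ z → x ≤ z
  ≤-trans (inj₁ x<y)  y≤z = inj₁ (<-≤-trans x<y y≤z)
  ≤-trans (inj₂ refl) y≤z = y≤z

  <⇒≱ : ∀ {x y} → x < y → ¬ (y ≤ x)
  <⇒≱ x<y y≤x = <-irrefl _ (<-≤-trans x<y y≤x)

  *-distribˡ-- : ∀ x y z → z * (y - x) ≡ (z * y) - (z * x)
  *-distribˡ-- = solve 3 (λ x y z → z :* (y :- x) := z :* y :- z :* x) refl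

  y-x+x≡y : ∀ x y → (y - x) + x ≡ y
  y-x+x≡y = solve 2 (λ x y → (y :- x) :+ x := y) refl

  x<y⇒0<y-x : ∀ {x y} → x < y → 0# < y - x
  x<y⇒0<y-x {x} x<y = subst (_< _) (-‿inverseʳ x) (+-mono-< (- x) x<y)

  0<y-x⇒x<y : ∀ {x y} → 0# < y - x → x < y
  0<y-x⇒x<y {x} {y} 0<y-x = subst₂ _<_ (+-identityˡ x) (y-x+x≡y x y) (+-mono-< x 0<y-x)

  x≤y⇒0≤y-x : ∀ {x y} → x ≤ y → 0# ≤ y - x
  x≤y⇒0≤y-x (inj₁ x<y)      = inj₁ (x<y⇒0<y-x x<y)
  x≤y⇒0≤y-x {x} (inj₂ refl) = inj₂ (sym (-‿inverseʳ x))

  0≤y-x⇒x≤y : ∀ {x y} → 0# ≤ y - x → x ≤ y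
  0≤y-x⇒x≤y (inj₁ 0<y-x)          = inj₁ (0<y-x⇒x<y 0<y-x)
  0≤y-x⇒x≤y {x} {y} (inj₂ 0≡y-x) = inj₂ (begin
    x             ≡⟨ +-identityˡ x ⟨
    0# + x        ≡⟨ cong (_+ x) 0≡y-x ⟩
    (y - x) + x   ≡⟨ y-x+x≡y x y ⟩
    y             ∎)
    where open ≡-Reasoning

  x<0⇒0<-x : ∀ {x} → x < 0# → 0# < - x
  x<0⇒0<-x {x} x<0 = subst (0# <_) (+-identityˡ (- x)) (x<y⇒0<y-x x<0)

  +-pos : ∀ {x y} → 0# < x → 0# < y → 0# < x + y
  +-pos {x} {y} 0<x 0<y = <-trans 0<y (subst (_< x + y) (+-identityˡ y) (+-mono-< y 0<x))

  +-nonneg : ∀ {x y} → 0# ≤ x → 0# ≤ y → 0# ≤ x + y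
  +-nonneg (inj₁ 0<x) (inj₁ 0<y)  = inj₁ (+-pos 0<x 0<y)
  +-nonneg {y = y} (inj₂ refl) 0≤y = subst (0# ≤_) (sym (+-identityˡ y)) 0≤y
  +-nonneg {x = x} 0≤x (inj₂ refl) = subst (0# ≤_) (sym (+-identityʳ x)) 0≤x

  *-nonneg : ∀ {x y} → 0# ≤ x → 0# ≤ y → 0# ≤ x * y
  *-nonneg (inj₁ 0<x) (inj₁ 0<y)  = inj₁ (*-pos 0<x 0<y)
  *-nonneg {y = y} (inj₂ refl) _  = inj₂ (sym (zeroˡ y))
  *-nonneg {x = x} _ (inj₂ refl)  = inj₂ (sym (zeroʳ x))

  -x*-x≡x*x : ∀ x → - x * - x ≡ x * x
  -x*-x≡x*x = solve 1 (λ x → (:- x) :* (:- x) := x :* x) refl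

  square-nonneg : ∀ x → 0# ≤ x * x
  square-nonneg x with <-tri x 0#
  ... | inj₁ x<0        = inj₁ (subst (0# <_) (-x*-x≡x*x x) (*-pos (x<0⇒0<-x x<0) (x<0⇒0<-x x<0)))
  ... | inj₂ (inj₁ refl) = inj₂ (sym (zeroˡ 0#))
  ... | inj₂ (inj₂ 0<x)  = inj₁ (*-pos 0<x 0<x)

  gaps≤span : ∀ {x x′ y y′} → x′ ≤ y → (x′ - x) + (y′ - y) ≤ y′ - x
  gaps≤span {x} {x′} {y} {y′} x′≤y = 0≤y-x⇒x≤y (subst (0# ≤_) (span-gaps x x′ y y′) (x≤y⇒0≤y-x x′≤y))
    where
    span-gaps : ∀ x x′ y y′ → y - x′ ≡ (y′ - x) - ((x′ - x) + (y′ - y))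
    span-gaps = solve 4 (λ x x′ y y′ → y :- x′ := (y′ :- x) :- ((x′ :- x) :+ (y′ :- y))) refl

  x≤x+y : ∀ {x y} → 0# ≤ y → x ≤ x + y
  x≤x+y {x} {y} 0≤y = 0≤y-x⇒x≤y (subst (0# ≤_) (x+y-x≡y x y) 0≤y)
    where
    x+y-x≡y : ∀ x y → y ≡ (x + y) - x
    x+y-x≡y = solve 2 (λ x y → y := (x :+ y) :- x) refl

  0<1 : 0# < 1#
  0<1 with square-nonneg 1#
  ... | inj₁ 0<1*1 = subst (0# <_) (*-identityˡ 1#) 0<1*1
  ... | inj₂ 0≡1*1 = ⊥-elim (0≢1 (trans 0≡1*1 (*-identityˡ 1#)))

  *-monoˡ-< : ∀ {x y z} → 0# < z → x < y → z * x < z * y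
  *-monoˡ-< {x} {y} {z} 0<z x<y =
    0<y-x⇒x<y (subst (0# <_) (*-distribˡ-- x y z) (*-pos 0<z (x<y⇒0<y-x x<y)))

  *-monoˡ-≤ : ∀ {x y z} → 0# ≤ z → x ≤ y → z * x ≤ z * y
  *-monoˡ-≤ {x} {y} {z} 0≤z x≤y =
    0≤y-x⇒x≤y (subst (0# ≤_) (*-distribˡ-- x y z) (*-nonneg 0≤z (x≤y⇒0≤y-x x≤y)))

  +-mono-<₂ : ∀ {x y z w} → x < y → z < w → x + z < y + w
  +-mono-<₂ {x} {y} {z} {w} x<y z<w =
    <-trans (+-mono-< z x<y) (subst₂ _<_ (+-comm z y) (+-comm w y) (+-mono-< y z<w))

  square-mono-≤ : ∀ {x y} → 0# ≤ x → x ≤ y → x * x ≤ y * y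
  square-mono-≤ {x} {y} 0≤x x≤y = 0≤y-x⇒x≤y (subst (0# ≤_) (difference-of-squares x y)
    (*-nonneg (x≤y⇒0≤y-x x≤y) (+-nonneg (≤-trans 0≤x x≤y) 0≤x)))
    where
    difference-of-squares : ∀ x y → (y - x) * (y + x) ≡ (y * y) - (x * x)
    difference-of-squares = solve 2 (λ x y → (y :- x) :* (y :+ x) := y :* y :- x :* x) refl

  square-<⇒< : ∀ {x y} → 0# ≤ y → x * x < y * y → x < y
  square-<⇒< {x} {y} 0≤y x²<y² with <-tri x y
  ... | inj₁ x<y        = x<y
  ... | inj₂ (inj₁ refl) = ⊥-elim (<-irrefl _ x²<y²)
  ... | inj₂ (inj₂ y<x)  = ⊥-elim (<⇒≱ x²<y² (square-mono-≤ 0≤y (inj₁ y<x)))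

  *-mono-< : ∀ {x y z w} → 0# ≤ x → x < y → 0# ≤ z → z < w → x * z < y * w
  *-mono-< {x} {y} {z} {w} 0≤x x<y 0≤z z<w = ≤-<-trans (*-monoˡ-≤ 0≤x (inj₁ z<w))
    (subst₂ _<_ (*-comm w x) (*-comm w y) (*-monoˡ-< (≤-<-trans 0≤z z<w) x<y))

  0<4 : 0# < 4#
  0<4 = *-pos (+-pos 0<1 0<1) (+-pos 0<1 0<1)

  4*-cancel-< : ∀ {x y} → 4# * x < 4# * y → x < y
  4*-cancel-< {x} {y} 4x<4y with <-tri x y
  ... | inj₁ x<y        = x<y
  ... | inj₂ (inj₁ refl) = ⊥-elim (<-irrefl _ 4x<4y)
  ... | inj₂ (inj₂ y<x)  = ⊥-elim (<-irrefl _ (<-trans 4x<4y (*-monoˡ-< 0<4 y<x)))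

  2*x≡x+x : ∀ x → 2# * x ≡ x + x
  2*x≡x+x x = trans (distribʳ x 1# 1#) (cong₂ _+_ (*-identityˡ x) (*-identityˡ x))

  x≤2*x : ∀ {x} → 0# ≤ x → x ≤ 2# * x
  x≤2*x {x} 0≤x = subst (x ≤_) (sym (2*x≡x+x x)) (x≤x+y 0≤x)

  x≤4*x : ∀ {x} → 0# ≤ x → x ≤ 4# * x
  x≤4*x {x} 0≤x = subst (x ≤_) (sym (*-assoc 2# 2# x))
    (≤-trans (x≤2*x 0≤x) (x≤2*x (≤-trans 0≤x (x≤2*x 0≤x))))

module PlaneGeometry (F : OrderedField) where
  open ≡ using (refl; sym; cong; cong₂; subst; subst₂)
  open OrderedField F
  open Geometry F
  open OrderedFieldProperties F

  dot cross : Point → Point → Carrier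
  dot   (x₁ , x₂) (y₁ , y₂) = x₁ * y₁ + x₂ * y₂
  cross (x₁ , x₂) (y₁ , y₂) = (x₁ * y₂) - (x₂ * y₁)

  normSq-nonneg : ∀ x → 0# ≤ normSq x
  normSq-nonneg (x₁ , x₂) = +-nonneg (square-nonneg x₁) (square-nonneg x₂)

  normSq-⊕ : ∀ x y → normSq (x ⊕ y) ≡ normSq x + (dot x y + dot x y) + normSq y
  normSq-⊕ (x₁ , x₂) (y₁ , y₂) = solve 4 (λ x₁ x₂ y₁ y₂ →
      (x₁ :+ y₁) :* (x₁ :+ y₁) :+ (x₂ :+ y₂) :* (x₂ :+ y₂)
      := (x₁ :* x₁ :+ x₂ :* x₂) :+ ((x₁ :* y₁ :+ x₂ :* y₂) :+ (x₁ :* y₁ :+ x₂ :* y₂))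
         :+ (y₁ :* y₁ :+ y₂ :* y₂))
    refl x₁ x₂ y₁ y₂

  lagrange-identity : ∀ x y → normSq x * normSq y ≡ dot x y * dot x y + cross x y * cross x y
  lagrange-identity (x₁ , x₂) (y₁ , y₂) = solve 4 (λ x₁ x₂ y₁ y₂ →
      (x₁ :* x₁ :+ x₂ :* x₂) :* (y₁ :* y₁ :+ y₂ :* y₂)
      := (x₁ :* y₁ :+ x₂ :* y₂) :* (x₁ :* y₁ :+ x₂ :* y₂)
         :+ (x₁ :* y₂ :- x₂ :* y₁) :* (x₁ :* y₂ :- x₂ :* y₁))
    refl x₁ x₂ y₁ y₂

  cauchy-schwarz : ∀ x y → dot x y * dot x y ≤ normSq x * normSq y
  cauchy-schwarz x y =
    subst (dot x y * dot x y ≤_) (sym (lagrange-identity x y)) (x≤x+y (square-nonneg (cross x y)))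

  normSq-⊕-< : ∀ {x y α β γ} → normSq x < α → normSq y < β → 0# ≤ γ → α * β ≤ γ * γ →
               normSq (x ⊕ y) < α + (γ + γ) + β
  normSq-⊕-< {x} {y} {α} {β} {γ} x<α y<β 0≤γ αβ≤γ² =
    subst (_< α + (γ + γ) + β) (sym (normSq-⊕ x y))
      (+-mono-<₂ (+-mono-<₂ x<α (+-mono-<₂ x·y<γ x·y<γ)) y<β)
    where
    x·y<γ : dot x y < γ
    x·y<γ = square-<⇒< 0≤γ (≤-<-trans (cauchy-schwarz x y)
      (<-≤-trans (*-mono-< (normSq-nonneg x) x<α (normSq-nonneg y) y<β) αβ≤γ²))

  distSq-sym : ∀ p q → distSq p q ≡ distSq q p
  distSq-sym (p₁ , p₂) (q₁ , q₂) = solve 4 (λ p₁ p₂ q₁ q₂ →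
      (p₁ :- q₁) :* (p₁ :- q₁) :+ (p₂ :- q₂) :* (p₂ :- q₂)
      := (q₁ :- p₁) :* (q₁ :- p₁) :+ (q₂ :- p₂) :* (q₂ :- p₂))
    refl p₁ p₂ q₁ q₂

  ⊖-telescope : ∀ p q r → (p ⊖ q) ⊕ (q ⊖ r) ≡ p ⊖ r
  ⊖-telescope (p₁ , p₂) (q₁ , q₂) (r₁ , r₂) = cong₂ _,_ (telescope p₁ q₁ r₁) (telescope p₂ q₂ r₂)
    where
    telescope : ∀ p q r → (p - q) + (q - r) ≡ p - r
    telescope = solve 3 (λ p q r → (p :- q) :+ (q :- r) := p :- r) refl

  -- γ stands in for √(αβ), which need not exist in F.
  distSq-triangle : ∀ {p q r α β γ} → distSq p q < α → distSq r q < β → 0# ≤ γ → α * β ≤ γ * γ →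
                    distSq p r < α + (γ + γ) + β
  distSq-triangle {p} {q} {r} {α} {β} {γ} pq<α rq<β 0≤γ αβ≤γ² =
    subst (_< α + (γ + γ) + β) (cong normSq (⊖-telescope p q r))
      (normSq-⊕-< pq<α (subst (_< β) (distSq-sym r q) rq<β) 0≤γ αβ≤γ²)

  distSq-on-line : ∀ a u s t → distSq (a ⊕ (t · u)) (a ⊕ (s · u)) ≡ normSq u * ((t - s) * (t - s))
  distSq-on-line (a₁ , a₂) (u₁ , u₂) s t = solve 6 (λ a₁ a₂ u₁ u₂ s t →
      ((a₁ :+ t :* u₁) :- (a₁ :+ s :* u₁)) :* ((a₁ :+ t :* u₁) :- (a₁ :+ s :* u₁))
      :+ ((a₂ :+ t :* u₂) :- (a₂ :+ s :* u₂)) :* ((a₂ :+ t :* u₂) :- (a₂ :+ s :* u₂))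
      := (u₁ :* u₁ :+ u₂ :* u₂) :* ((t :- s) :* (t :- s)))
    refl a₁ a₂ u₁ u₂ s t

  line-disks-disjoint : ∀ a u q {s t A B} → 0# ≤ A → 0# ≤ B → A + B ≤ t - s →
    distSq (a ⊕ (s · u)) q < normSq u * (A * A) → distSq (a ⊕ (t · u)) q < normSq u * (B * B) → ⊥
  line-disks-disjoint a u q {s} {t} {A} {B} 0≤A 0≤B A+B≤t-s near-s near-t =
    <⇒≱ (distSq-triangle near-t near-s 0≤γ (inj₂ (βα≡γ² N A B))) radii≤distance
    where
    N γ : Carrier
    N = normSq u
    γ = N * (A * B)
    0≤γ : 0# ≤ γ
    0≤γ = *-nonneg (normSq-nonneg u) (*-nonneg 0≤A 0≤B)
    βα≡γ² : ∀ N A B → (N * (B * B)) * (N * (A * A)) ≡ (N * (A * B)) * (N * (A * B))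
    βα≡γ² = solve 3 (λ N A B →
      (N :* (B :* B)) :* (N :* (A :* A)) := (N :* (A :* B)) :* (N :* (A :* B))) refl
    square-of-sum : ∀ N A B →
      N * ((A + B) * (A + B)) ≡ N * (B * B) + (N * (A * B) + N * (A * B)) + N * (A * A)
    square-of-sum = solve 3 (λ N A B → N :* ((A :+ B) :* (A :+ B))
      := N :* (B :* B) :+ (N :* (A :* B) :+ N :* (A :* B)) :+ N :* (A :* A)) refl
    radii≤distance : N * (B * B) + (γ + γ) + N * (A * A) ≤ distSq (a ⊕ (t · u)) (a ⊕ (s · u))
    radii≤distance = subst₂ _≤_ (square-of-sum N A B) (sym (distSq-on-line a u s t))
      (*-monoˡ-≤ (normSq-nonneg u) (square-mono-≤ (+-nonneg 0≤A 0≤B) A+B≤t-s))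

module TwoDrawingProperties (F : OrderedField) where
  open ≡ using (refl; trans; cong₂; subst₂)
  open OrderedField F
  open Geometry F
  open OrderedFieldProperties F
  open PlaneGeometry F

  incident⇒vertex< : ∀ {m e j} → Incident m e j → j ℕ.< m
  incident⇒vertex< {e = e} (e+1<m , inj₁ refl) = ℕ.<-trans (ℕ.n<1+n e) e+1<m
  incident⇒vertex<         (e+1<m , inj₂ refl) = e+1<m

  incident-edges-comparable : ∀ {m v e e′ j} → RatioCondition m v →
    Incident m e j → Incident m e′ j → lenSq v e′ ≤ 4# * lenSq v e
  incident-edges-comparable ratio (_ , inj₁ refl) (_ , inj₁ refl) = x≤4*x (normSq-nonneg _)
  incident-edges-comparable ratio (e+1<m , inj₁ refl) (_ , inj₂ refl) = proj₁ (ratio _ e+1<m)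
  incident-edges-comparable ratio (_ , inj₂ refl) (e′+1<m , inj₁ refl) = proj₂ (ratio _ e′+1<m)
  incident-edges-comparable ratio (_ , inj₂ refl) (_ , inj₂ refl) = x≤4*x (normSq-nonneg _)

  inPlyDisk⇒distSq< : ∀ {m v q j L} → (∀ e → Incident m e j → lenSq v e ≤ 4# * L) →
    InPlyDisk m v q j → distSq (v j) q < L
  inPlyDisk⇒distSq< bound (e , e∼j , 4d<ℓ) = 4*-cancel-< (<-≤-trans 4d<ℓ (bound e e∼j))

  inPlyDisk⇒distSq<lenSq : ∀ {m v q e j} → RatioCondition m v → Incident m e j →
    InPlyDisk m v q j → distSq (v j) q < lenSq v e
  inPlyDisk⇒distSq<lenSq ratio e∼j =
    inPlyDisk⇒distSq< (λ _ e′∼j → incident-edges-comparable ratio e∼j e′∼j)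

  stepwise-≤⇒monotone : ∀ {m} (t : ℕ → Carrier) → (∀ i → suc i ℕ.< m → t i ≤ t (suc i)) →
    ∀ {i k} → i ℕ.≤ k → k ℕ.< m → t i ≤ t k
  stepwise-≤⇒monotone t step {k = zero}  ℕ.z≤n _ = ≤-refl
  stepwise-≤⇒monotone t step {k = suc k} i≤k+1 k+1<m with ℕ.m≤n⇒m<n∨m≡n i≤k+1
  ... | inj₂ refl = ≤-refl
  ... | inj₁ i<k+1 = ≤-trans
    (stepwise-≤⇒monotone t step (ℕ.s≤s⁻¹ i<k+1) (ℕ.<-trans (ℕ.n<1+n k) k+1<m)) (step k k+1<m)

  ply-disks-disjoint : ∀ {m v q i k} → TwoDrawing m v → suc i ℕ.< k → k ℕ.< m →
    InPlyDisk m v q i → InPlyDisk m v q k → ⊥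
  ply-disks-disjoint {m} {v} {q} {i} {suc k}
    ((a , b , t , onSegment , ordered) , ratio) i+1<k+1 k+1<m q∈Dᵢ q∈Dₖ =
    line-disks-disjoint a u q (δ-nonneg i+1<m) (δ-nonneg k+1<m) gaps
      (near (i+1<m , inj₁ refl) q∈Dᵢ) (near (k+1<m , inj₂ refl) q∈Dₖ)
    where
    u : Point
    u = b ⊖ a

    δ : ℕ → Carrier
    δ e = t (suc e) - t e

    δ-nonneg : ∀ {e} → suc e ℕ.< m → 0# ≤ δ e
    δ-nonneg {e} e+1<m = x≤y⇒0≤y-x (ordered e e+1<m)

    position : ∀ {j} → j ℕ.< m → v j ≡ a ⊕ (t j · u)
    position j<m = proj₂ (proj₂ (onSegment _ j<m))

    lenSq≡ : ∀ {e} → suc e ℕ.< m → lenSq v e ≡ normSq u * (δ e * δ e)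
    lenSq≡ {e} e+1<m =
      trans (cong₂ distSq (position e+1<m) (position (ℕ.<-trans (ℕ.n<1+n e) e+1<m)))
            (distSq-on-line a u (t e) (t (suc e)))

    near : ∀ {e j} → Incident m e j → InPlyDisk m v q j →
           distSq (a ⊕ (t j · u)) q < normSq u * (δ e * δ e)
    near e∼j q∈D = subst₂ (λ p r → distSq p q < r)
      (position (incident⇒vertex< e∼j)) (lenSq≡ (proj₁ e∼j)) (inPlyDisk⇒distSq<lenSq ratio e∼j q∈D)

    i+1≤k : suc i ℕ.≤ k
    i+1≤k = ℕ.s≤s⁻¹ i+1<k+1

    i+1<m : suc i ℕ.< m
    i+1<m = ℕ.<-trans i+1<k+1 k+1<m

    gaps : δ i + δ k ≤ t (suc k) - t i
    gaps = gaps≤span (stepwise-≤⇒monotone t ordered i+1≤k (ℕ.<-trans (ℕ.n<1+n k) k+1<m))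

open import Data.Nat using (_<_)

lemma5 : (F : OrderedField) → let open Geometry F in
    (m : ℕ) (v : ℕ → Point) → TwoDrawing m v →
    (q : Point) (i j k : ℕ) → i < j → j < k → k < m →
    ¬ (InPlyDisk m v q i × InPlyDisk m v q j × InPlyDisk m v q k)
lemma5 F m v drawing q i j k i<j j<k k<m (q∈Dᵢ , _ , q∈Dₖ) =
  ply-disks-disjoint drawing (ℕ.≤-<-trans i<j j<k) k<m q∈Dᵢ q∈Dₖ
  where open TwoDrawingProperties F
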